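{- For integers $k\geq1$ and $n_1,\dots,n_{k}\geq0$, we have \[ \sum_{\substack{t_1,\dots,t_k\ge0 \\ t_1=t_k=0}} \prod_{i=1}^{k-1} q^{t_{i+1}(n_{i+1} - t_i + t_{i+1})} \binom{n_i+t_i}{n_i}_q \binom{n_i+n_{i+1}}{n_i+t_i-t_{i+1}}_q = \frac{[n_1+\cdots+n_k]_q!}{[n_1]_q!\cdots[n_k]_q!}. \]
   Context: Here $[m]_q=1+q+\cdots+q^{m-1}$, $[m]_q!=[1]_q[2]_q\cdots[m]_q$, and $\binom{m}{j}_q=\frac{[m]_q!}{[j]_q![m-j]_q!}$ is the $q$-binomial coefficient (zero if $j<0$ or $j>m$); the right-hand side is the $q$-multinomial coefficient. -}

module Defs where

open import Data.Nat using (ℕ; zero; suc; _+_; _*_; _∸_; _^_; _/_; _≤ᵇ_; _≡ᵇ_; NonZero; >-nonZero; s≤s; z≤n)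
open import Data.Nat.Properties using (m*n≢0)
open import Data.Bool using (Bool; true; false; if_then_else_; _∧_)
open import Data.Nat.ListAction using (sum; product)
open import Data.List using (List; []; _∷_; map; upTo; concatMap; filterᵇ; tabulate)
open import Data.Vec using (Vec; []; _∷_; lookup; head; last; toList)
open import Data.Fin using (Fin; inject₁) renaming (suc to fsuc)

qint : ℕ → ℕ → ℕ
qint q m = sum (map (q ^_) (upTo m))

qfact : ℕ → ℕ → ℕ
qfact q zero    = 1
qfact q (suc m) = qint q (suc m) * qfact q m

qint-suc-nonZero : ∀ q m → NonZero (qint q (suc m))
qint-suc-nonZero q m = >-nonZero (s≤s z≤n)

qfact-nonZero : ∀ q m → NonZero (qfact q m)
qfact-nonZero q zero    = _
qfact-nonZero q (suc m) =
  m*n≢0 (qint q (suc m)) (qfact q m) {{qint-suc-nonZero q m}} {{qfact-nonZero q m}}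

qbinom : ℕ → ℕ → ℕ → ℕ
qbinom q m j =
  if j ≤ᵇ m
  then _/_ (qfact q m) (qfact q j * qfact q (m ∸ j))
         {{m*n≢0 (qfact q j) (qfact q (m ∸ j)) {{qfact-nonZero q j}} {{qfact-nonZero q (m ∸ j)}}}}
  else 0

-- q-binomial  binom(m, a - b)_q  with an integer lower index a - b
-- (zero when a - b < 0, i.e. when b > a)
qbinomDiff : ℕ → ℕ → ℕ → ℕ → ℕ
qbinomDiff q m a b = if b ≤ᵇ a then qbinom q m (a ∸ b) else 0

prodQfact : ℕ → List ℕ → ℕ
prodQfact q []       = 1
prodQfact q (x ∷ xs) = qfact q x * prodQfact q xs

prodQfact-nonZero : ∀ q xs → NonZero (prodQfact q xs)
prodQfact-nonZero q []       = _
prodQfact-nonZero q (x ∷ xs) =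
  m*n≢0 (qfact q x) (prodQfact q xs) {{qfact-nonZero q x}} {{prodQfact-nonZero q xs}}

qmultinom : ℕ → List ℕ → ℕ
qmultinom q ns = _/_ (qfact q (sum ns)) (prodQfact q ns) {{prodQfact-nonZero q ns}}

-- When n' - t + t' < 0 the last binomial vanishes (its lower index exceeds
-- n + n'), so truncated subtraction in the exponent is harmless.
factor : ℕ → ℕ → ℕ → ℕ → ℕ → ℕ
factor q n n' t t' =
  q ^ (t' * (n' + t' ∸ t)) * qbinom q (n + t) n * qbinomDiff q (n + n') (n + t) t'

tuples : (k B : ℕ) → List (Vec ℕ k)
tuples zero    B = [] ∷ []
tuples (suc k) B = concatMap (λ x → map (x ∷_) (tuples k B)) (upTo (suc B))

summand : ℕ → {m : ℕ} → Vec ℕ (suc m) → Vec ℕ (suc m) → ℕ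
summand q {m} n t =
  product (tabulate {n = m} (λ i →
    factor q (lookup n (inject₁ i)) (lookup n (fsuc i))
             (lookup t (inject₁ i)) (lookup t (fsuc i))))

boundary : {m : ℕ} → Vec ℕ (suc m) → Bool
boundary t = (head t ≡ᵇ 0) ∧ (last t ≡ᵇ 0)

-- partial sum of the left-hand side over t_1, ..., t_k ∈ {0, ..., B}
-- with t_1 = t_k = 0
lhsBox : ℕ → {m : ℕ} → Vec ℕ (suc m) → ℕ → ℕ
lhsBox q {m} n B = sum (map (summand q n) (filterᵇ boundary (tuples (suc m) B)))

-- Replace the factorial quotients by the q-binomials of the q-Pascal recursion
-- C(m+1, j+1) = C(m, j) + q^(j+1) C(m, j+1).  Fix t₁ = t and sum over t₂, …, t_k
-- (with t_k = 0): by induction on k this partial sum is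
--   C(n₁+t, n₁) · C(n₁+r, n₁+t) · multinom(n₂, …, n_k),   r = n₂ + ⋯ + n_k.
-- In the induction step the inner sum over t₂ = y is collapsed by the identity
-- C(n₂+y, n₂) C(n₂+r, n₂+y) = C(n₂+r, n₂) C(r, y), which moves the y-dependence
-- into C(r, y), followed by the q-Vandermonde convolution.  At t = 0 the closed
-- form is the q-multinomial coefficient, and since C(r, y) = 0 for y > r the box
-- partial sums are constant from B = n₁ + ⋯ + n_k on.
module Submission where

open import Defs
open import Data.Nat using (ℕ; zero; suc; _+_; _*_; _∸_; _^_; _≤_; _<_; _/_; _≤ᵇ_; _≡ᵇ_; NonZero; z≤n; s≤s; _≤?_; _<?_)
open import Data.Nat.Properties
open import Data.Nat.DivMod using (m*n/n≡m)
open import Data.Nat.ListAction using (sum)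
open import Data.Nat.ListAction.Properties using (sum-++)
open import Data.Nat.Solver using (module +-*-Solver)
open import Data.Bool using (Bool; true; false; if_then_else_)
open import Data.Bool.Properties using (T-≡; ¬-not)
open import Data.List using (List; []; _∷_; _++_; map; upTo; applyUpTo; concatMap; filterᵇ)
open import Data.List.Properties using (map-++; map-∘; map-cong; map-upTo; map-applyUpTo)
open import Data.Vec using (Vec; []; _∷_; toList; last)
open import Data.Product using (∃; _,_)
open import Function.Bundles using (Equivalence)
open import Relation.Nullary using (yes; no)
open import Relation.Binary.PropositionalEquality
open ≡-Reasoning
open +-*-Solver using (solve; con; _:+_; _:*_; _:=_)

≤ᵇ-true : ∀ {m n} → m ≤ n → (m ≤ᵇ n) ≡ true
≤ᵇ-true m≤n = Equivalence.to T-≡ (≤⇒≤ᵇ m≤n)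

≤ᵇ-false : ∀ {m n} → n < m → (m ≤ᵇ n) ≡ false
≤ᵇ-false {m} {n} n<m = ¬-not λ m≤ᵇn → <⇒≱ n<m (≤ᵇ⇒≤ m n (Equivalence.from T-≡ m≤ᵇn))

≤ᵇ-suc : ∀ m n → (suc m ≤ᵇ suc n) ≡ (m ≤ᵇ n)
≤ᵇ-suc zero    n = refl
≤ᵇ-suc (suc m) n = refl

if-*ˡ : ∀ b c x → (if b then c * x else 0) ≡ c * (if b then x else 0)
if-*ˡ true  c x = refl
if-*ˡ false c x = sym (*-zeroʳ c)

sum-map-*ˡ : ∀ {A : Set} c (f : A → ℕ) xs → sum (map (λ x → c * f x) xs) ≡ c * sum (map f xs)
sum-map-*ˡ c f []       = sym (*-zeroʳ c)
sum-map-*ˡ c f (x ∷ xs) = trans (cong (c * f x +_) (sum-map-*ˡ c f xs)) (sym (*-distribˡ-+ c (f x) _))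

sum-map-zero : ∀ {A : Set} (xs : List A) → sum (map (λ _ → 0) xs) ≡ 0
sum-map-zero []       = refl
sum-map-zero (x ∷ xs) = sum-map-zero xs

sum-map-filterᵇ : ∀ {A : Set} (p : A → Bool) (f : A → ℕ) xs →
  sum (map f (filterᵇ p xs)) ≡ sum (map (λ x → if p x then f x else 0) xs)
sum-map-filterᵇ p f []       = refl
sum-map-filterᵇ p f (x ∷ xs) with p x
... | true  = cong (f x +_) (sum-map-filterᵇ p f xs)
... | false = sum-map-filterᵇ p f xs

sum-map-concatMap : ∀ {A B : Set} (f : B → ℕ) (g : A → List B) xs →
  sum (map f (concatMap g xs)) ≡ sum (map (λ x → sum (map f (g x))) xs)
sum-map-concatMap f g []       = refl
sum-map-concatMap f g (x ∷ xs) = begin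
  sum (map f (g x ++ concatMap g xs))              ≡⟨ cong sum (map-++ f (g x) _) ⟩
  sum (map f (g x) ++ map f (concatMap g xs))      ≡⟨ sum-++ (map f (g x)) _ ⟩
  sum (map f (g x)) + sum (map f (concatMap g xs)) ≡⟨ cong (sum (map f (g x)) +_) (sum-map-concatMap f g xs) ⟩
  sum (map f (g x)) + sum (map (λ x → sum (map f (g x))) xs) ∎

∑< : ℕ → (ℕ → ℕ) → ℕ
∑< n f = sum (applyUpTo f n)

syntax ∑< n (λ j → e) = ∑[ j < n ] e

∑<-cong : ∀ n {f g} → (∀ j → f j ≡ g j) → ∑< n f ≡ ∑< n g
∑<-cong zero    f≗g = refl
∑<-cong (suc n) f≗g = cong₂ _+_ (f≗g 0) (∑<-cong n (λ j → f≗g (suc j)))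

∑<-*ˡ : ∀ n c f → ∑[ j < n ] (c * f j) ≡ c * ∑< n f
∑<-*ˡ zero    c f = sym (*-zeroʳ c)
∑<-*ˡ (suc n) c f = trans (cong (c * f 0 +_) (∑<-*ˡ n c (λ j → f (suc j)))) (sym (*-distribˡ-+ c (f 0) _))

∑<-zero : ∀ n f → (∀ j → f j ≡ 0) → ∑< n f ≡ 0
∑<-zero zero    f f≡0 = refl
∑<-zero (suc n) f f≡0 = cong₂ _+_ (f≡0 0) (∑<-zero n (λ j → f (suc j)) (λ j → f≡0 (suc j)))

∑<-truncate : ∀ n e f → (∀ j → n ≤ j → f j ≡ 0) → ∑< (n + e) f ≡ ∑< n f
∑<-truncate zero    e f f≡0 = ∑<-zero e f (λ j → f≡0 j z≤n)
∑<-truncate (suc n) e f f≡0 = cong (f 0 +_) (∑<-truncate n e (λ j → f (suc j)) (λ j n≤j → f≡0 (suc j) (s≤s n≤j)))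

∑<-resize : ∀ m n f → (∀ j → m ≤ j → f j ≡ 0) → (∀ j → n ≤ j → f j ≡ 0) → ∑< m f ≡ ∑< n f
∑<-resize m n f vanishₘ vanishₙ = begin
  ∑< m f       ≡⟨ sym (∑<-truncate m n f vanishₘ) ⟩
  ∑< (m + n) f ≡⟨ cong (λ k → ∑< k f) (+-comm m n) ⟩
  ∑< (n + m) f ≡⟨ ∑<-truncate n m f vanishₙ ⟩
  ∑< n f       ∎

-- Σ_{i+j=k} g i j
antidiagonal : (ℕ → ℕ → ℕ) → ℕ → ℕ
antidiagonal g zero    = g 0 0
antidiagonal g (suc k) = g (suc k) 0 + antidiagonal (λ i j → g i (suc j)) k

antidiagonal-cong : ∀ k {f g} → (∀ i j → f i j ≡ g i j) → antidiagonal f k ≡ antidiagonal g k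
antidiagonal-cong zero    f≗g = f≗g 0 0
antidiagonal-cong (suc k) f≗g = cong₂ _+_ (f≗g (suc k) 0) (antidiagonal-cong k (λ i j → f≗g i (suc j)))

antidiagonal-+ : ∀ k f g → antidiagonal (λ i j → f i j + g i j) k ≡ antidiagonal f k + antidiagonal g k
antidiagonal-+ zero    f g = refl
antidiagonal-+ (suc k) f g = begin
  f (suc k) 0 + g (suc k) 0 + antidiagonal (λ i j → f i (suc j) + g i (suc j)) k
    ≡⟨ cong (f (suc k) 0 + g (suc k) 0 +_) (antidiagonal-+ k (λ i j → f i (suc j)) (λ i j → g i (suc j))) ⟩
  f (suc k) 0 + g (suc k) 0 + (F + G)
    ≡⟨ solve 4 (λ a b c d → a :+ b :+ (c :+ d) := (a :+ c) :+ (b :+ d)) refl (f (suc k) 0) (g (suc k) 0) F G ⟩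
  antidiagonal f (suc k) + antidiagonal g (suc k) ∎
  where
  F = antidiagonal (λ i j → f i (suc j)) k
  G = antidiagonal (λ i j → g i (suc j)) k

antidiagonal-*ˡ : ∀ k c g → antidiagonal (λ i j → c * g i j) k ≡ c * antidiagonal g k
antidiagonal-*ˡ zero    c g = refl
antidiagonal-*ˡ (suc k) c g =
  trans (cong (c * g (suc k) 0 +_) (antidiagonal-*ˡ k c (λ i j → g i (suc j)))) (sym (*-distribˡ-+ c _ _))

antidiagonal-^ : ∀ q k g → antidiagonal (λ i j → q ^ (i + j) * g i j) k ≡ q ^ k * antidiagonal g k
antidiagonal-^ q zero    g = refl
antidiagonal-^ q (suc k) g = begin
  q ^ (suc k + 0) * g (suc k) 0 + antidiagonal (λ i j → q ^ (i + suc j) * g i (suc j)) k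
    ≡⟨ cong₂ _+_ (cong (λ e → q ^ e * g (suc k) 0) (+-identityʳ (suc k)))
                 (antidiagonal-cong k λ i j → trans (cong (λ e → q ^ e * g i (suc j)) (+-suc i j))
                                                    (*-assoc q (q ^ (i + j)) (g i (suc j)))) ⟩
  q ^ suc k * g (suc k) 0 + antidiagonal (λ i j → q * (q ^ (i + j) * g i (suc j))) k
    ≡⟨ cong (q ^ suc k * g (suc k) 0 +_)
            (trans (antidiagonal-*ˡ k q _) (cong (q *_) (antidiagonal-^ q k (λ i j → g i (suc j))))) ⟩
  q ^ suc k * g (suc k) 0 + q * (q ^ k * G)
    ≡⟨ cong (q ^ suc k * g (suc k) 0 +_) (sym (*-assoc q (q ^ k) G)) ⟩
  q ^ suc k * g (suc k) 0 + q ^ suc k * G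
    ≡⟨ sym (*-distribˡ-+ (q ^ suc k) _ _) ⟩
  q ^ suc k * antidiagonal g (suc k) ∎
  where G = antidiagonal (λ i j → g i (suc j)) k

shiftˡ : (ℕ → ℕ → ℕ) → ℕ → ℕ → ℕ
shiftˡ g zero    j = 0
shiftˡ g (suc i) j = g i j

antidiagonal-shiftˡ : ∀ k g → antidiagonal (shiftˡ g) (suc k) ≡ antidiagonal g k
antidiagonal-shiftˡ zero    g = +-identityʳ (g 0 0)
antidiagonal-shiftˡ (suc k) g = cong (g (suc k) 0 +_) (begin
  antidiagonal (λ i j → shiftˡ g i (suc j)) (suc k)
    ≡⟨ antidiagonal-cong (suc k) {f = λ i j → shiftˡ g i (suc j)} {g = shiftˡ (λ i j → g i (suc j))} (λ { zero j → refl ; (suc i) j → refl }) ⟩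
  antidiagonal (shiftˡ (λ i j → g i (suc j))) (suc k)
    ≡⟨ antidiagonal-shiftˡ k (λ i j → g i (suc j)) ⟩
  antidiagonal (λ i j → g i (suc j)) k ∎)

antidiagonal-column : ∀ k g → (∀ i j → g (suc i) j ≡ 0) → antidiagonal g k ≡ g 0 k
antidiagonal-column zero    g g≡0 = refl
antidiagonal-column (suc k) g g≡0 =
  cong₂ _+_ (g≡0 k 0) (antidiagonal-column k (λ i j → g i (suc j)) (λ i j → g≡0 i (suc j)))

antidiagonal≡∑< : ∀ k g → antidiagonal g k ≡ ∑[ j < suc k ] (if j ≤ᵇ k then g (k ∸ j) j else 0)
antidiagonal≡∑< zero    g = sym (+-identityʳ (g 0 0))
antidiagonal≡∑< (suc k) g = cong (g (suc k) 0 +_) (trans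
  (antidiagonal≡∑< k (λ i j → g i (suc j)))
  (∑<-cong (suc k) λ j → cong (λ b → if b then g (k ∸ j) (suc j) else 0) (sym (≤ᵇ-suc j k))))

antidiagonal≡∑<-bounded : ∀ k B g → (∀ i j → B < j → g i j ≡ 0) →
  antidiagonal g k ≡ ∑[ j < suc B ] (if j ≤ᵇ k then g (k ∸ j) j else 0)
antidiagonal≡∑<-bounded k B g g≡0 = trans (antidiagonal≡∑< k g) (∑<-resize (suc k) (suc B) h vanishₖ vanishB)
  where
  h : ℕ → ℕ
  h j = if j ≤ᵇ k then g (k ∸ j) j else 0
  vanishₖ : ∀ j → suc k ≤ j → h j ≡ 0
  vanishₖ j k<j rewrite ≤ᵇ-false k<j = refl
  vanishB : ∀ j → suc B ≤ j → h j ≡ 0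
  vanishB j B<j with j ≤ᵇ k
  ... | true  = g≡0 (k ∸ j) j B<j
  ... | false = refl

module _ (q : ℕ) where

  qint-suc : ∀ m → qint q (suc m) ≡ 1 + q * qint q m
  qint-suc m = cong (1 +_) (begin
    sum (map (q ^_) (applyUpTo suc m))
      ≡⟨ cong sum (trans (map-applyUpTo suc (q ^_) m) (sym (map-upTo (λ i → q * q ^ i) m))) ⟩
    sum (map (λ i → q * q ^ i) (upTo m))
      ≡⟨ sum-map-*ˡ q (q ^_) (upTo m) ⟩
    q * qint q m ∎)

  qint-+ : ∀ a b → qint q (a + b) ≡ qint q a + q ^ a * qint q b
  qint-+ zero    b = sym (+-identityʳ (qint q b))
  qint-+ (suc a) b = begin
    qint q (suc (a + b))                   ≡⟨ qint-suc (a + b) ⟩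
    1 + q * qint q (a + b)                 ≡⟨ cong (λ x → 1 + q * x) (qint-+ a b) ⟩
    1 + q * (qint q a + q ^ a * qint q b)
      ≡⟨ solve 4 (λ Q A P B → con 1 :+ Q :* (A :+ P :* B) := (con 1 :+ Q :* A) :+ (Q :* P) :* B)
               refl q (qint q a) (q ^ a) (qint q b) ⟩
    (1 + q * qint q a) + q ^ suc a * qint q b ≡⟨ cong (_+ q ^ suc a * qint q b) (sym (qint-suc a)) ⟩
    qint q (suc a) + q ^ suc a * qint q b  ∎

  pascal : ℕ → ℕ → ℕ
  pascal m       zero    = 1
  pascal zero    (suc j) = 0
  pascal (suc m) (suc j) = pascal m j + q ^ suc j * pascal m (suc j)

  pascal-> : ∀ m j → m < j → pascal m j ≡ 0
  pascal-> zero    (suc j) _ = refl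
  pascal-> (suc m) (suc j) (s≤s m<j)
    rewrite pascal-> m j m<j | pascal-> m (suc j) (m<n⇒m<1+n m<j) = *-zeroʳ (q ^ suc j)

  pascal-diag : ∀ m → pascal m m ≡ 1
  pascal-diag zero = refl
  pascal-diag (suc m) rewrite pascal-diag m | pascal-> m (suc m) ≤-refl | *-zeroʳ (q ^ suc m) = refl

  pascal-*-qfact : ∀ i j → pascal (i + j) i * (qfact q i * qfact q j) ≡ qfact q (i + j)
  pascal-*-qfact zero    j = trans (*-identityˡ _) (*-identityˡ _)
  pascal-*-qfact (suc i) zero rewrite +-identityʳ i | pascal-diag (suc i) = trans (*-identityˡ _) (*-identityʳ _)
  pascal-*-qfact (suc i) (suc j) = begin
    (A + Z * B) * ((Ii * fi) * (Ij * fj))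
      ≡⟨ solve 7 (λ A Z B Ii fi Ij fj → (A :+ Z :* B) :* ((Ii :* fi) :* (Ij :* fj))
                  := Ii :* (A :* (fi :* (Ij :* fj))) :+ Z :* Ij :* (B :* ((Ii :* fi) :* fj)))
               refl A Z B Ii fi Ij fj ⟩
    Ii * (A * (fi * (Ij * fj))) + Z * Ij * (B * ((Ii * fi) * fj))
      ≡⟨ cong₂ (λ x y → Ii * x + Z * Ij * y) (pascal-*-qfact i (suc j)) left ⟩
    Ii * F + Z * Ij * F                    ≡⟨ sym (*-distribʳ-+ F Ii (Z * Ij)) ⟩
    (Ii + Z * Ij) * F                      ≡⟨ cong (_* F) (sym (qint-+ (suc i) (suc j))) ⟩
    qint q (suc i + suc j) * F             ∎
    where
    A = pascal (i + suc j) i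
    B = pascal (i + suc j) (suc i)
    Z = q ^ suc i
    Ii = qint q (suc i)
    Ij = qint q (suc j)
    fi = qfact q i
    fj = qfact q j
    F = qfact q (i + suc j)
    left : B * ((Ii * fi) * fj) ≡ F
    left = subst (λ n → pascal n (suc i) * ((Ii * fi) * fj) ≡ qfact q n) (sym (+-suc i j)) (pascal-*-qfact (suc i) j)

  qfact²-nonZero : ∀ a b → NonZero (qfact q a * qfact q b)
  qfact²-nonZero a b = m*n≢0 (qfact q a) (qfact q b) {{qfact-nonZero q a}} {{qfact-nonZero q b}}

  qbinom≡pascal : ∀ m j → qbinom q m j ≡ pascal m j
  qbinom≡pascal m j with j ≤? m
  ... | yes j≤m rewrite ≤ᵇ-true j≤m = begin
    _/_ (qfact q m) D {{qfact²-nonZero j (m ∸ j)}}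
      ≡⟨ cong (λ x → _/_ x D {{qfact²-nonZero j (m ∸ j)}}) (sym product≡) ⟩
    _/_ (pascal m j * D) D {{qfact²-nonZero j (m ∸ j)}}
      ≡⟨ m*n/n≡m (pascal m j) D {{qfact²-nonZero j (m ∸ j)}} ⟩
    pascal m j ∎
    where
    D = qfact q j * qfact q (m ∸ j)
    product≡ : pascal m j * D ≡ qfact q m
    product≡ = subst (λ n → pascal n j * D ≡ qfact q n) (m+[n∸m]≡n j≤m) (pascal-*-qfact j (m ∸ j))
  ... | no j≰m rewrite ≤ᵇ-false (≰⇒> j≰m) = sym (pascal-> m j (≰⇒> j≰m))

  pascal-trinomial-≤ : ∀ b y s → pascal (b + y) b * pascal (b + (y + s)) (b + y) ≡ pascal (b + (y + s)) b * pascal (y + s) y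
  pascal-trinomial-≤ b y s = *-cancelʳ-≡ _ _ (fb * fy * fs) {{nonZero}} (begin
    pascal (b + y) b * pascal (b + (y + s)) (b + y) * (fb * fy * fs)
      ≡⟨ solve 5 (λ X Y fb fy fs → X :* Y :* (fb :* fy :* fs) := Y :* ((X :* (fb :* fy)) :* fs)) refl
               (pascal (b + y) b) (pascal (b + (y + s)) (b + y)) fb fy fs ⟩
    pascal (b + (y + s)) (b + y) * (pascal (b + y) b * (fb * fy) * fs)
      ≡⟨ cong (λ x → pascal (b + (y + s)) (b + y) * (x * fs)) (pascal-*-qfact b y) ⟩
    pascal (b + (y + s)) (b + y) * (qfact q (b + y) * fs)
      ≡⟨ subst (λ n → pascal n (b + y) * (qfact q (b + y) * fs) ≡ qfact q n) (+-assoc b y s) (pascal-*-qfact (b + y) s) ⟩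
    qfact q (b + (y + s))
      ≡⟨ sym (pascal-*-qfact b (y + s)) ⟩
    pascal (b + (y + s)) b * (fb * qfact q (y + s))
      ≡⟨ cong (λ x → pascal (b + (y + s)) b * (fb * x)) (sym (pascal-*-qfact y s)) ⟩
    pascal (b + (y + s)) b * (fb * (pascal (y + s) y * (fy * fs)))
      ≡⟨ solve 5 (λ X Y fb fy fs → X :* (fb :* (Y :* (fy :* fs))) := X :* Y :* (fb :* fy :* fs)) refl
               (pascal (b + (y + s)) b) (pascal (y + s) y) fb fy fs ⟩
    pascal (b + (y + s)) b * pascal (y + s) y * (fb * fy * fs) ∎)
    where
    fb = qfact q b
    fy = qfact q y
    fs = qfact q s
    nonZero : NonZero (fb * fy * fs)
    nonZero = m*n≢0 (fb * fy) fs {{qfact²-nonZero b y}} {{qfact-nonZero q s}}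

  pascal-trinomial : ∀ b y r → pascal (b + y) b * pascal (b + r) (b + y) ≡ pascal (b + r) b * pascal r y
  pascal-trinomial b y r with y ≤? r
  ... | yes y≤r = subst (λ n → pascal (b + y) b * pascal (b + n) (b + y) ≡ pascal (b + n) b * pascal n y)
                        (m+[n∸m]≡n y≤r) (pascal-trinomial-≤ b y (r ∸ y))
  ... | no y≰r rewrite pascal-> (b + r) (b + y) (+-monoʳ-< b (≰⇒> y≰r)) | pascal-> r y (≰⇒> y≰r)
    = trans (*-zeroʳ (pascal (b + y) b)) (sym (*-zeroʳ (pascal (b + r) b)))

  vandermondeTerm : ℕ → ℕ → ℕ → ℕ → ℕ
  vandermondeTerm m p i j = q ^ (j * (m ∸ i)) * pascal m i * pascal p j

  q^[j*suc] : ∀ j x → q ^ (j * suc x) ≡ q ^ j * q ^ (j * x)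
  q^[j*suc] j x = trans (cong (q ^_) (*-suc j x)) (^-distribˡ-+-* q j (j * x))

  vandermondeTerm-suc : ∀ m p i j →
    vandermondeTerm (suc m) p i j ≡ shiftˡ (vandermondeTerm m p) i j + q ^ (i + j) * vandermondeTerm m p i j
  vandermondeTerm-suc m p zero j rewrite q^[j*suc] j m =
    solve 3 (λ X Y Cp → X :* Y :* con 1 :* Cp := con 0 :+ X :* (Y :* con 1 :* Cp)) refl (q ^ j) (q ^ (j * m)) (pascal p j)
  vandermondeTerm-suc m p (suc i) j with i <? m
  ... | yes i<m rewrite +-∸-assoc 1 i<m | q^[j*suc] j (m ∸ suc i) | ^-distribˡ-+-* q (suc i) j =
    solve 6 (λ X Y Z A B Cp → X :* Y :* (A :+ Z :* B) :* Cp := X :* Y :* A :* Cp :+ Z :* X :* (Y :* B :* Cp)) refl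
      (q ^ j) (q ^ (j * (m ∸ suc i))) (q ^ suc i) (pascal m i) (pascal m (suc i)) (pascal p j)
  ... | no i≮m rewrite pascal-> m (suc i) (s≤s (≮⇒≥ i≮m)) =
    solve 6 (λ E Z Z′ Y A Cp → E :* (A :+ Z :* con 0) :* Cp := E :* A :* Cp :+ Z′ :* (Y :* con 0 :* Cp)) refl
      (q ^ (j * (m ∸ i))) (q ^ suc i) (q ^ (suc i + j)) (q ^ (j * (m ∸ suc i))) (pascal m i) (pascal p j)

  q-vandermonde : ∀ m p k → pascal (m + p) k ≡ antidiagonal (vandermondeTerm m p) k
  q-vandermonde zero p k = sym (trans (antidiagonal-column k (vandermondeTerm zero p) outside)
                                      (trans (cong (λ e → q ^ e * 1 * pascal p k) (*-zeroʳ k)) (*-identityˡ (pascal p k))))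
    where
    outside : ∀ i j → vandermondeTerm zero p (suc i) j ≡ 0
    outside i j = cong (_* pascal p j) (*-zeroʳ (q ^ (j * 0)))
  q-vandermonde (suc m) p zero    = refl
  q-vandermonde (suc m) p (suc k) = begin
    pascal (m + p) k + q ^ suc k * pascal (m + p) (suc k)
      ≡⟨ cong₂ (λ x y → x + q ^ suc k * y) (q-vandermonde m p k) (q-vandermonde m p (suc k)) ⟩
    antidiagonal V k + q ^ suc k * antidiagonal V (suc k)
      ≡⟨ cong₂ _+_ (sym (antidiagonal-shiftˡ k V)) (sym (antidiagonal-^ q (suc k) V)) ⟩
    antidiagonal (shiftˡ V) (suc k) + antidiagonal (λ i j → q ^ (i + j) * V i j) (suc k)
      ≡⟨ sym (antidiagonal-+ (suc k) (shiftˡ V) (λ i j → q ^ (i + j) * V i j)) ⟩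
    antidiagonal (λ i j → shiftˡ V i j + q ^ (i + j) * V i j) (suc k)
      ≡⟨ antidiagonal-cong (suc k) (λ i j → sym (vandermondeTerm-suc m p i j)) ⟩
    antidiagonal (vandermondeTerm (suc m) p) (suc k) ∎
    where V = vandermondeTerm m p

  -- the paper's weight q^(y(b+y−t)) is the Vandermonde weight q^(j(m−i)) at m = a+b, i = a+t−y, j = y
  exponent-≡ : ∀ a b t y → y ≤ a + t → (a + b) ∸ (a + t ∸ y) ≡ b + y ∸ t
  exponent-≡ a b t y y≤a+t = begin
    (a + b) ∸ i             ≡⟨ sym ([m+n]∸[m+o]≡n∸o y (a + b) i) ⟩
    (y + (a + b)) ∸ (y + i) ≡⟨ cong₂ _∸_ (solve 3 (λ y a b → y :+ (a :+ b) := a :+ (b :+ y)) refl y a b)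
                                         (trans (+-comm y i) (m∸n+n≡m y≤a+t)) ⟩
    (a + (b + y)) ∸ (a + t) ≡⟨ [m+n]∸[m+o]≡n∸o a (b + y) t ⟩
    b + y ∸ t               ∎
    where i = a + t ∸ y

  q-vandermonde-∑< : ∀ a b r t B → r ≤ B →
    ∑[ y < suc B ] (q ^ (y * (b + y ∸ t)) * qbinomDiff q (a + b) (a + t) y * pascal r y) ≡ pascal (a + (b + r)) (a + t)
  q-vandermonde-∑< a b r t B r≤B = begin
    ∑[ y < suc B ] (q ^ (y * (b + y ∸ t)) * qbinomDiff q (a + b) (a + t) y * pascal r y)
      ≡⟨ ∑<-cong (suc B) term≡ ⟩
    ∑[ y < suc B ] (if y ≤ᵇ a + t then V (a + t ∸ y) y else 0)
      ≡⟨ sym (antidiagonal≡∑<-bounded (a + t) B V outside) ⟩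
    antidiagonal V (a + t)        ≡⟨ sym (q-vandermonde (a + b) r (a + t)) ⟩
    pascal (a + b + r) (a + t)    ≡⟨ cong (λ n → pascal n (a + t)) (+-assoc a b r) ⟩
    pascal (a + (b + r)) (a + t)  ∎
    where
    V = vandermondeTerm (a + b) r
    outside : ∀ i j → B < j → V i j ≡ 0
    outside i j B<j rewrite pascal-> r j (≤-<-trans r≤B B<j) = *-zeroʳ (q ^ (j * (a + b ∸ i)) * pascal (a + b) i)
    term≡ : ∀ y → q ^ (y * (b + y ∸ t)) * qbinomDiff q (a + b) (a + t) y * pascal r y
                ≡ (if y ≤ᵇ a + t then V (a + t ∸ y) y else 0)
    term≡ y with y ≤? a + t
    ... | yes y≤a+t rewrite ≤ᵇ-true y≤a+t | qbinom≡pascal (a + b) (a + t ∸ y) | exponent-≡ a b t y y≤a+t = refl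
    ... | no y≰a+t rewrite ≤ᵇ-false (≰⇒> y≰a+t) | *-zeroʳ (q ^ (y * (b + y ∸ t))) = refl

  multinomial : List ℕ → ℕ
  multinomial []       = 1
  multinomial (x ∷ xs) = pascal (x + sum xs) x * multinomial xs

  multinomial-*-prodQfact : ∀ xs → multinomial xs * prodQfact q xs ≡ qfact q (sum xs)
  multinomial-*-prodQfact []       = refl
  multinomial-*-prodQfact (x ∷ xs) = begin
    C * M * (qfact q x * P)     ≡⟨ solve 4 (λ C M f P → C :* M :* (f :* P) := C :* (f :* (M :* P))) refl C M (qfact q x) P ⟩
    C * (qfact q x * (M * P))   ≡⟨ cong (λ z → C * (qfact q x * z)) (multinomial-*-prodQfact xs) ⟩
    C * (qfact q x * qfact q (sum xs)) ≡⟨ pascal-*-qfact x (sum xs) ⟩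
    qfact q (x + sum xs)        ∎
    where
    C = pascal (x + sum xs) x
    M = multinomial xs
    P = prodQfact q xs

  qmultinom≡multinomial : ∀ xs → qmultinom q xs ≡ multinomial xs
  qmultinom≡multinomial xs =
    trans (cong (λ z → _/_ z (prodQfact q xs) {{prodQfact-nonZero q xs}}) (sym (multinomial-*-prodQfact xs)))
          (m*n/n≡m (multinomial xs) (prodQfact q xs) {{prodQfact-nonZero q xs}})

  lhsBoxFrom : ∀ {m} → Vec ℕ (suc m) → ℕ → ℕ → ℕ
  lhsBoxFrom {m} n t B = sum (map (λ v → if last (t ∷ v) ≡ᵇ 0 then summand q n (t ∷ v) else 0) (tuples m B))

  lhsBoxFrom-∷ : ∀ {m} n₁ n₂ (ns : Vec ℕ m) t B →
    lhsBoxFrom (n₁ ∷ n₂ ∷ ns) t B ≡ ∑[ y < suc B ] (factor q n₁ n₂ t y * lhsBoxFrom (n₂ ∷ ns) y B)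
  lhsBoxFrom-∷ {m} n₁ n₂ ns t B = begin
    lhsBoxFrom (n₁ ∷ n₂ ∷ ns) t B
      ≡⟨ sum-map-concatMap F (λ y → map (y ∷_) (tuples m B)) (upTo (suc B)) ⟩
    sum (map (λ y → sum (map F (map (y ∷_) (tuples m B)))) (upTo (suc B)))
      ≡⟨ cong sum (map-upTo _ (suc B)) ⟩
    ∑[ y < suc B ] sum (map F (map (y ∷_) (tuples m B)))
      ≡⟨ ∑<-cong (suc B) column ⟩
    ∑[ y < suc B ] (factor q n₁ n₂ t y * lhsBoxFrom (n₂ ∷ ns) y B) ∎
    where
    F : Vec ℕ (suc m) → ℕ
    F v = if last (t ∷ v) ≡ᵇ 0 then summand q (n₁ ∷ n₂ ∷ ns) (t ∷ v) else 0
    column : ∀ y → sum (map F (map (y ∷_) (tuples m B))) ≡ factor q n₁ n₂ t y * lhsBoxFrom (n₂ ∷ ns) y B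
    column y = begin
      sum (map F (map (y ∷_) (tuples m B)))
        ≡⟨ cong sum (sym (map-∘ (tuples m B))) ⟩
      sum (map (λ w → F (y ∷ w)) (tuples m B))
        ≡⟨ cong sum (map-cong (λ w → if-*ˡ (last (y ∷ w) ≡ᵇ 0) (factor q n₁ n₂ t y) (summand q (n₂ ∷ ns) (y ∷ w))) (tuples m B)) ⟩
      sum (map (λ w → factor q n₁ n₂ t y * (if last (y ∷ w) ≡ᵇ 0 then summand q (n₂ ∷ ns) (y ∷ w) else 0)) (tuples m B))
        ≡⟨ sum-map-*ˡ (factor q n₁ n₂ t y) _ (tuples m B) ⟩
      factor q n₁ n₂ t y * lhsBoxFrom (n₂ ∷ ns) y B ∎

  lhsBox≡lhsBoxFrom-0 : ∀ {m} (n : Vec ℕ (suc m)) B → lhsBox q n B ≡ lhsBoxFrom n 0 B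
  lhsBox≡lhsBoxFrom-0 {m} n B = begin
    lhsBox q n B
      ≡⟨ sum-map-filterᵇ boundary (summand q n) (tuples (suc m) B) ⟩
    sum (map G (tuples (suc m) B))
      ≡⟨ sum-map-concatMap G (λ x → map (x ∷_) (tuples m B)) (upTo (suc B)) ⟩
    sum (map (λ x → sum (map G (map (x ∷_) (tuples m B)))) (upTo (suc B)))
      ≡⟨ cong sum (map-upTo _ (suc B)) ⟩
    ∑[ x < suc B ] sum (map G (map (x ∷_) (tuples m B)))
      ≡⟨ cong₂ _+_ (cong sum (sym (map-∘ (tuples m B))))
                   (∑<-zero B _ λ x → trans (cong sum (sym (map-∘ (tuples m B)))) (sum-map-zero (tuples m B))) ⟩
    lhsBoxFrom n 0 B + 0
      ≡⟨ +-identityʳ _ ⟩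
    lhsBoxFrom n 0 B ∎
    where
    G : Vec ℕ (suc m) → ℕ
    G v = if boundary v then summand q n v else 0

  lhsBoxFrom-closed : ∀ {m} n₁ (ns : Vec ℕ m) t B → n₁ + sum (toList ns) ≤ B →
    lhsBoxFrom (n₁ ∷ ns) t B ≡ pascal (n₁ + t) n₁ * pascal (n₁ + sum (toList ns)) (n₁ + t) * multinomial (toList ns)
  lhsBoxFrom-closed n₁ [] zero B _ rewrite +-identityʳ n₁ | pascal-diag n₁ = refl
  lhsBoxFrom-closed n₁ [] (suc t) B _
    rewrite pascal-> (n₁ + 0) (n₁ + suc t) (+-monoʳ-< n₁ (s≤s z≤n)) | *-zeroʳ (pascal (n₁ + suc t) n₁) = refl
  lhsBoxFrom-closed n₁ (n₂ ∷ ns) t B n≤B = begin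
    lhsBoxFrom (n₁ ∷ n₂ ∷ ns) t B
      ≡⟨ lhsBoxFrom-∷ n₁ n₂ ns t B ⟩
    ∑[ y < suc B ] (factor q n₁ n₂ t y * lhsBoxFrom (n₂ ∷ ns) y B)
      ≡⟨ ∑<-cong (suc B) (λ y → cong (factor q n₁ n₂ t y *_) (lhsBoxFrom-closed n₂ ns y B n₂+r≤B)) ⟩
    ∑[ y < suc B ] (factor q n₁ n₂ t y * (pascal (n₂ + y) n₂ * pascal (n₂ + r) (n₂ + y) * M))
      ≡⟨ ∑<-cong (suc B) term≡ ⟩
    ∑[ y < suc B ] (K * (q ^ (y * (n₂ + y ∸ t)) * qbinomDiff q (n₁ + n₂) (n₁ + t) y * pascal r y))
      ≡⟨ ∑<-*ˡ (suc B) K (λ y → q ^ (y * (n₂ + y ∸ t)) * qbinomDiff q (n₁ + n₂) (n₁ + t) y * pascal r y) ⟩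
    K * ∑[ y < suc B ] (q ^ (y * (n₂ + y ∸ t)) * qbinomDiff q (n₁ + n₂) (n₁ + t) y * pascal r y)
      ≡⟨ cong (K *_) (q-vandermonde-∑< n₁ n₂ r t B (≤-trans (m≤n+m r n₂) n₂+r≤B)) ⟩
    K * pascal (n₁ + (n₂ + r)) (n₁ + t)
      ≡⟨ solve 4 (λ a b c d → a :* b :* c :* d := a :* d :* (b :* c)) refl
               (pascal (n₁ + t) n₁) (pascal (n₂ + r) n₂) M (pascal (n₁ + (n₂ + r)) (n₁ + t)) ⟩
    pascal (n₁ + t) n₁ * pascal (n₁ + (n₂ + r)) (n₁ + t) * (pascal (n₂ + r) n₂ * M) ∎
    where
    r = sum (toList ns)
    M = multinomial (toList ns)
    K = pascal (n₁ + t) n₁ * pascal (n₂ + r) n₂ * M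
    n₂+r≤B : n₂ + r ≤ B
    n₂+r≤B = ≤-trans (m≤n+m (n₂ + r) n₁) n≤B
    term≡ : ∀ y → factor q n₁ n₂ t y * (pascal (n₂ + y) n₂ * pascal (n₂ + r) (n₂ + y) * M)
                ≡ K * (q ^ (y * (n₂ + y ∸ t)) * qbinomDiff q (n₁ + n₂) (n₁ + t) y * pascal r y)
    term≡ y rewrite qbinom≡pascal (n₁ + t) n₁ = begin
      E * X * D * (Y₁ * Y₂ * M)
        ≡⟨ solve 6 (λ E X D Y₁ Y₂ M → E :* X :* D :* (Y₁ :* Y₂ :* M) := E :* X :* D :* (Y₁ :* Y₂) :* M) refl E X D Y₁ Y₂ M ⟩
      E * X * D * (Y₁ * Y₂) * M
        ≡⟨ cong (λ z → E * X * D * z * M) (pascal-trinomial n₂ y r) ⟩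
      E * X * D * (pascal (n₂ + r) n₂ * pascal r y) * M
        ≡⟨ solve 6 (λ E X D Cb Cr M → E :* X :* D :* (Cb :* Cr) :* M := X :* Cb :* M :* (E :* D :* Cr)) refl
                 E X D (pascal (n₂ + r) n₂) (pascal r y) M ⟩
      K * (E * D * pascal r y) ∎
      where
      E = q ^ (y * (n₂ + y ∸ t))
      X = pascal (n₁ + t) n₁
      D = qbinomDiff q (n₁ + n₂) (n₁ + t) y
      Y₁ = pascal (n₂ + y) n₂
      Y₂ = pascal (n₂ + r) (n₂ + y)

lemma4p2 : (q m : ℕ) (n : Vec ℕ (suc m)) →
    ∃ λ B₀ → (B : ℕ) → B₀ ≤ B → lhsBox q n B ≡ qmultinom q (toList n)
lemma4p2 q m (n₁ ∷ ns) = sum (toList (n₁ ∷ ns)) , λ B n≤B → begin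
  lhsBox q (n₁ ∷ ns) B
    ≡⟨ lhsBox≡lhsBoxFrom-0 q (n₁ ∷ ns) B ⟩
  lhsBoxFrom q (n₁ ∷ ns) 0 B
    ≡⟨ lhsBoxFrom-closed q n₁ ns 0 B n≤B ⟩
  pascal q (n₁ + 0) n₁ * pascal q (n₁ + r) (n₁ + 0) * multinomial q (toList ns)
    ≡⟨ cong (λ z → pascal q z n₁ * pascal q (n₁ + r) z * multinomial q (toList ns)) (+-identityʳ n₁) ⟩
  pascal q n₁ n₁ * pascal q (n₁ + r) n₁ * multinomial q (toList ns)
    ≡⟨ cong (λ z → z * pascal q (n₁ + r) n₁ * multinomial q (toList ns)) (pascal-diag q n₁) ⟩
  1 * pascal q (n₁ + r) n₁ * multinomial q (toList ns)
    ≡⟨ cong (_* multinomial q (toList ns)) (*-identityˡ (pascal q (n₁ + r) n₁)) ⟩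
  multinomial q (toList (n₁ ∷ ns))
    ≡⟨ sym (qmultinom≡multinomial q (toList (n₁ ∷ ns))) ⟩
  qmultinom q (toList (n₁ ∷ ns)) ∎
  where r = sum (toList ns)
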